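{- Let $w$ be a minimal element of $\mathcal{C}_n$. (a) An index $d$ is a descent of $w$ if and only if $w(d+1)$ bumps $w(d)$ to the second row during RSK insertion. (b) Every value $w(d) \in \mathrm{Row}_2(P(w))$ is bumped (to the second row) by $w(d+1)$.
   Context: A permutation is fully commutative iff it avoids $321$; $d$ is a descent if $w(d)>w(d+1)$. $P(w)$ is the RSK (row-)insertion tableau; during insertion of $x$ into the first row, $x$ bumps the smallest entry larger than $x$ into the second row. $\mathrm{Row}_2(P(w))$ is the set of second-row entries. A set $L$ of integers is crowded if there exist integers $x>0$, $y$ with $|[y,y+2x]\cap L|>x+1$. $\mathcal{C}_n$ is the set of fully commutative $w\in S_n$ with $\mathrm{Row}_2(P(w))$ crowded, and minimal means minimal in $\mathcal{C}_n$ with respect to the right weak order (the transitive closure of $u<us_i$ whenever $\ell(us_i)>\ell(u)$). -}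

module Defs where

open import Data.Nat using (ℕ; zero; suc; _+_; _*_; _<_; _≤_; _>_; _<ᵇ_)
open import Data.Nat.Properties using (_<?_)
open import Data.Bool using (Bool; true; false; if_then_else_)
open import Data.List using (List; []; _∷_; length; filter; take; foldl; upTo; map)
open import Data.List.Membership.Propositional using (_∈_)
open import Data.List.Relation.Binary.Permutation.Propositional using (_↭_)
open import Data.Maybe using (Maybe; just; nothing)
open import Data.Product using (_×_; _,_; ∃; ∃-syntax; Σ)
open import Data.Integer as ℤ using (ℤ; +_)
import Data.Integer.Properties as ℤP
open import Relation.Nullary using (¬_)
open import Relation.Nullary.Decidable using (_×-dec_)
open import Relation.Binary.PropositionalEquality using (_≡_)
open import Relation.Binary.Construct.Closure.ReflexiveTransitive using (Star)

-- Permutations w ∈ S_n are written in one-line notation as lists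
-- [w(1), …, w(n)] which are rearrangements of [1, …, n].

-- 1-based lookup w(i); returns 0 outside 1..length.
at : List ℕ → ℕ → ℕ
at []       _             = 0
at (x ∷ xs) zero          = 0
at (x ∷ xs) (suc zero)    = x
at (x ∷ xs) (suc (suc i)) = at xs (suc i)

IsPerm : ℕ → List ℕ → Set
IsPerm n w = w ↭ map suc (upTo n)

Contains321 : ℕ → List ℕ → Set
Contains321 n w = ∃[ i ] ∃[ j ] ∃[ k ]
  (1 ≤ i × i < j × j < k × k ≤ n × at w i > at w j × at w j > at w k)

FullyCommutative : ℕ → List ℕ → Set
FullyCommutative n w = IsPerm n w × ¬ Contains321 n w

Descent : ℕ → List ℕ → ℕ → Set
Descent n w d = 1 ≤ d × d < n × at w d > at w (suc d)

Tableau : Set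
Tableau = List (List ℕ)

rowInsert : ℕ → List ℕ → List ℕ × Maybe ℕ
rowInsert x []       = (x ∷ [] , nothing)
rowInsert x (y ∷ ys) with x <ᵇ y
... | true  = (x ∷ ys , just y)
... | false with rowInsert x ys
...   | (r , b) = (y ∷ r , b)

insert : Tableau → ℕ → Tableau
insert []       x = (x ∷ []) ∷ []
insert (r ∷ rs) x with rowInsert x r
... | (r' , nothing) = r' ∷ rs
... | (r' , just y)  = r' ∷ insert rs y

P : List ℕ → Tableau
P w = foldl insert [] w

firstRowBump : Tableau → ℕ → Maybe ℕ
firstRowBump []      x = nothing
firstRowBump (r ∷ _) x with rowInsert x r
... | (_ , b) = b

Row₂ : Tableau → List ℕ
Row₂ (_ ∷ r ∷ _) = r
Row₂ _           = []

-- "w(d+1) bumps w(d) to the second row": when inserting w(d+1) into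
-- P(w(1) … w(d)), the entry bumped out of the first row is w(d).
BumpedBy : List ℕ → ℕ → Set
BumpedBy w d = firstRowBump (P (take d w)) (at w (suc d)) ≡ just (at w d)

countIn : ℤ → ℤ → List ℕ → ℕ
countIn a b L = length (filter (λ l → (a ℤ.≤? + l) ×-dec (+ l ℤ.≤? b)) L)

-- L is crowded if ∃ x > 0, y ∈ ℤ with |[y, y+2x] ∩ L| > x + 1
-- (L is given by a duplicate-free list, as Row₂ of a tableau is)
Crowded : List ℕ → Set
Crowded L = ∃[ x ] Σ ℤ λ y → x > 0 × countIn y (y ℤ.+ + (2 * x)) L > x + 1

InC : ℕ → List ℕ → Set
InC n w = FullyCommutative n w × Crowded (Row₂ (P w))

len : List ℕ → ℕ
len []       = 0
len (x ∷ xs) = length (filter (λ y → y <? x) xs) + len xs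

-- u s_i : swap positions i and i+1 (1-based)
swapAt : ℕ → List ℕ → List ℕ
swapAt (suc zero)    (a ∷ b ∷ xs) = b ∷ a ∷ xs
swapAt (suc (suc i)) (a ∷ xs)     = a ∷ swapAt (suc i) xs
swapAt _             xs           = xs

WeakStep : ℕ → List ℕ → List ℕ → Set
WeakStep n u v = ∃[ i ] (1 ≤ i × i < n × v ≡ swapAt i u × len v > len u)

_≤R[_]_ : List ℕ → ℕ → List ℕ → Set
u ≤R[ n ] v = Star (WeakStep n) u v

MinimalInC : ℕ → List ℕ → Set
MinimalInC n w = InC n w × (∀ u → InC n u → u ≤R[ n ] w → u ≡ w)

-- Let w be minimal in 𝒞ₙ and d a descent, w = p a b s with b < a.  Inserting a
-- into the first row R of P(p) bumps nothing, since a bumped y ∈ p would give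
-- the 321-pattern y a b.  If b then bumped some y ∈ R instead of a, the Knuth
-- relation would give P(p b a s) = P(w); but p b a s is still fully commutative,
-- lies in 𝒞ₙ and is strictly below w in the weak order, contradicting minimality.
-- So b bumps a, which is (a).  For (b): if a = w(d) reaches the second row, some
-- later entry e < a must be inserted; let e be the first such.  If e does not
-- immediately follow a, the entry c preceding it is larger than a and by (a) e
-- bumps c, although a < c is still in the first row and e < a.  So w(d+1) = e,
-- d is a descent, and (a) applies.

module Submission where

open import Defs
open import Data.Nat using (ℕ; zero; suc; _+_; _≤_; _<_; _>_; _<ᵇ_; z≤n; s≤s; _≟_)
open import Data.Nat.Properties
open import Data.Bool using (true; false)
open import Data.List
  using (List; []; _∷_; _++_; _∷ʳ_; concat; foldl; length; take; drop; filter; upTo; initLast; _∷ʳ′_)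
open import Data.List.Properties
  using (foldl-++; ++-assoc; ++-cancelˡ; ∷-injectiveˡ; length-map; length-applyUpTo; filter-accept; filter-reject)
open import Data.List.Membership.Propositional using (_∈_; _∉_)
open import Data.List.Membership.Propositional.Properties using (∈-++⁺ˡ; ∈-++⁺ʳ; ∈-++⁻)
open import Data.List.Relation.Unary.Any using (here; there)
open import Data.List.Relation.Unary.All as All using (All; []; _∷_)
open import Data.List.Relation.Unary.All.Properties using (++⁻ˡ)
import Data.List.Relation.Unary.First as First
open import Data.List.Relation.Unary.First.Properties using (toView)
open import Data.List.Relation.Unary.Unique.Propositional using (Unique; _∷_)
open import Data.List.Relation.Unary.Unique.Propositional.Properties using (upTo⁺; map⁺)
open import Data.List.Relation.Binary.Permutation.Propositional using (_↭_; ↭-refl; ↭-sym; ↭-trans; swap; ↭⇒↭ₛ)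
open import Data.List.Relation.Binary.Permutation.Propositional.Properties using (↭-length; filter-↭; ++⁺ˡ)
import Data.List.Relation.Binary.Permutation.Setoid.Properties as ↭ₛ
open import Relation.Binary.Construct.Closure.ReflexiveTransitive using (ε; _◅_)
open import Data.Maybe using (Maybe; just; nothing)
open import Data.Product using (_×_; _,_; proj₁; proj₂; ∃-syntax)
open import Data.Sum using (_⊎_; inj₁; inj₂; [_,_]′) renaming (map₂ to ⊎-map₂; swap to ⊎-swap)
open import Data.Empty using (⊥-elim)
open import Function using (_∘_)
open import Relation.Nullary using (¬_; yes; no)
open import Relation.Nullary.Reflects using (ofʸ; ofⁿ)
open import Function.Bundles using (_⇔_; mk⇔)
open import Relation.Binary.PropositionalEquality

at-middle : ∀ p (a : ℕ) s → at (p ++ a ∷ s) (suc (length p)) ≡ a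
at-middle []      a s = refl
at-middle (x ∷ p) a s = at-middle p a s

at-middle-next : ∀ p (a b : ℕ) s → at (p ++ a ∷ b ∷ s) (suc (suc (length p))) ≡ b
at-middle-next []      a b s = refl
at-middle-next (x ∷ p) a b s = at-middle-next p a b s

at-++ˡ : ∀ p q i → i ≤ length p → at (p ++ q) i ≡ at p i
at-++ˡ []      []      zero          _         = refl
at-++ˡ []      (x ∷ q) zero          _         = refl
at-++ˡ (x ∷ p) q       zero          _         = refl
at-++ˡ (x ∷ p) q       (suc zero)    _         = refl
at-++ˡ (x ∷ p) q       (suc (suc i)) (s≤s i≤p) = at-++ˡ p q (suc i) i≤p

at-swap-outside : ∀ p (a b : ℕ) s i → i ≢ suc (length p) → i ≢ suc (suc (length p)) →
                  at (p ++ b ∷ a ∷ s) i ≡ at (p ++ a ∷ b ∷ s) i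
at-swap-outside []      a b s zero                _  _  = refl
at-swap-outside []      a b s (suc zero)          i≢ _  = ⊥-elim (i≢ refl)
at-swap-outside []      a b s (suc (suc zero))    _  i≢ = ⊥-elim (i≢ refl)
at-swap-outside []      a b s (suc (suc (suc i))) _  _  = refl
at-swap-outside (x ∷ p) a b s zero                _  _  = refl
at-swap-outside (x ∷ p) a b s (suc zero)          _  _  = refl
at-swap-outside (x ∷ p) a b s (suc (suc i))       i≢ i≢′ =
  at-swap-outside p a b s (suc i) (i≢ ∘ cong suc) (i≢′ ∘ cong suc)

∈⇒at : ∀ {p} {y : ℕ} → y ∈ p → ∃[ i ] (1 ≤ i × i ≤ length p × at p i ≡ y)
∈⇒at (here refl) = 1 , s≤s z≤n , s≤s z≤n , refl
∈⇒at (there y∈p) with ∈⇒at y∈p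
... | suc i , _ , i≤p , wᵢ≡y = suc (suc i) , s≤s z≤n , s≤s i≤p , wᵢ≡y

take-middle : ∀ p (a : ℕ) s → take (suc (length p)) (p ++ a ∷ s) ≡ p ++ a ∷ []
take-middle []      a s = refl
take-middle (x ∷ p) a s = cong (x ∷_) (take-middle p a s)

swapAt-middle : ∀ p (a b : ℕ) s → swapAt (suc (length p)) (p ++ b ∷ a ∷ s) ≡ p ++ a ∷ b ∷ s
swapAt-middle []      a b s = refl
swapAt-middle (x ∷ p) a b s = cong (x ∷_) (swapAt-middle p a b s)

middle-next<length : ∀ p (a b : ℕ) s → suc (length p) < length (p ++ a ∷ b ∷ s)
middle-next<length []      a b s = s≤s (s≤s z≤n)
middle-next<length (x ∷ p) a b s = s≤s (middle-next<length p a b s)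

split-at : ∀ (w : List ℕ) k → k < length w → ∃[ p ] ∃[ a ] ∃[ s ] (w ≡ p ++ a ∷ s × length p ≡ k)
split-at (x ∷ w) zero    _         = [] , x , w , refl , refl
split-at (x ∷ w) (suc k) (s≤s k<w) with split-at w k k<w
... | p , a , s , refl , refl = x ∷ p , a , s , refl , refl

split-at₂ : ∀ (w : List ℕ) k → suc k < length w →
            ∃[ p ] ∃[ a ] ∃[ b ] ∃[ s ] (w ≡ p ++ a ∷ b ∷ s × length p ≡ k)
split-at₂ (x ∷ y ∷ w) zero    _         = [] , x , y , w , refl , refl
split-at₂ (x ∷ w)     (suc k) (s≤s k<w) with split-at₂ w k k<w
... | p , a , b , s , refl , refl = x ∷ p , a , b , s , refl , refl

transposeAt : ℕ → ℕ → ℕ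
transposeAt K i with i ≟ suc K | i ≟ suc (suc K)
... | yes _ | _     = suc (suc K)
... | no _  | yes _ = suc K
... | no _  | no _  = i

at-transposeAt : ∀ p (a b : ℕ) s i → at (p ++ b ∷ a ∷ s) i ≡ at (p ++ a ∷ b ∷ s) (transposeAt (length p) i)
at-transposeAt p a b s i with i ≟ suc (length p) | i ≟ suc (suc (length p))
... | yes refl | _        = trans (at-middle p b (a ∷ s)) (sym (at-middle-next p a b s))
... | no _      | yes refl = trans (at-middle-next p b a s) (sym (at-middle p a (b ∷ s)))
... | no i≢     | no i≢′   = at-swap-outside p a b s i i≢ i≢′

transposeAt-mono : ∀ K i j → i < j → ¬ (i ≡ suc K × j ≡ suc (suc K)) → transposeAt K i < transposeAt K j
transposeAt-mono K i j i<j ¬swapped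
  with i ≟ suc K | i ≟ suc (suc K) | j ≟ suc K | j ≟ suc (suc K)
... | yes i≡  | _        | yes j≡ | _        = ⊥-elim (<-irrefl (trans i≡ (sym j≡)) i<j)
... | yes i≡  | _        | no _   | yes j≡   = ⊥-elim (¬swapped (i≡ , j≡))
... | yes refl | _       | no _   | no j≢′   = ≤∧≢⇒< i<j (j≢′ ∘ sym)
... | no _    | yes refl | yes refl | _      = ⊥-elim (<-asym i<j (n<1+n (suc K)))
... | no _    | yes i≡   | no _   | yes j≡   = ⊥-elim (<-irrefl (trans i≡ (sym j≡)) i<j)
... | no _    | yes refl | no _   | no _     = <-trans (n<1+n (suc K)) i<j
... | no _    | no _     | yes refl | _      = <-trans i<j (n<1+n (suc K))
... | no i≢   | no _     | no _   | yes refl = ≤∧≢⇒< (≤-pred i<j) i≢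
... | no _    | no _     | no _   | no _     = i<j

transposeAt-pos : ∀ K i → 1 ≤ i → 1 ≤ transposeAt K i
transposeAt-pos K i 1≤i with i ≟ suc K | i ≟ suc (suc K)
... | yes _ | _     = s≤s z≤n
... | no _  | yes _ = s≤s z≤n
... | no _  | no _  = 1≤i

transposeAt-≤ : ∀ K i n → i ≤ n → suc K < n → transposeAt K i ≤ n
transposeAt-≤ K i n i≤n K+1<n with i ≟ suc K | i ≟ suc (suc K)
... | yes _ | _     = K+1<n
... | no _  | yes _ = <⇒≤ K+1<n
... | no _  | no _  = i≤n

Contains321-addInversion : ∀ n p {a b : ℕ} s → b < a → suc (length p) < n →
                           Contains321 n (p ++ b ∷ a ∷ s) → Contains321 n (p ++ a ∷ b ∷ s)
Contains321-addInversion n p {a} {b} s b<a K+1<n (i , j , k , 1≤i , i<j , j<k , k≤n , wᵢ>wⱼ , wⱼ>wₖ) =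
  τ i , τ j , τ k , transposeAt-pos K i 1≤i ,
  transposeAt-mono K i j i<j (notAscent wᵢ>wⱼ) , transposeAt-mono K j k j<k (notAscent wⱼ>wₖ) ,
  transposeAt-≤ K k n k≤n K+1<n ,
  subst₂ _>_ (at-transposeAt p a b s i) (at-transposeAt p a b s j) wᵢ>wⱼ ,
  subst₂ _>_ (at-transposeAt p a b s j) (at-transposeAt p a b s k) wⱼ>wₖ
  where
  K = length p
  τ = transposeAt K
  -- positions K+1, K+2 of p b a s hold the ascent b < a, so they are never both used
  notAscent : ∀ {x y} → at (p ++ b ∷ a ∷ s) x > at (p ++ b ∷ a ∷ s) y → ¬ (x ≡ suc K × y ≡ suc (suc K))
  notAscent wₓ>wᵧ (refl , refl) = <-asym b<a (subst₂ _>_ (at-middle p b (a ∷ s)) (at-middle-next p b a s) wₓ>wᵧ)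

IsPerm⇒length : ∀ {n w} → IsPerm n w → length w ≡ n
IsPerm⇒length {n} w↭ = trans (↭-length w↭) (trans (length-map suc (upTo n)) (length-applyUpTo (λ i → i) n))

IsPerm⇒Unique : ∀ {n w} → IsPerm n w → Unique w
IsPerm⇒Unique {n} w↭ = ↭ₛ.Unique-resp-↭ (setoid ℕ) (↭⇒↭ₛ (↭-sym w↭)) (map⁺ suc-injective (upTo⁺ n))

Unique-middle : ∀ p {a : ℕ} s → Unique (p ++ a ∷ s) → a ∉ p × a ∉ s
Unique-middle []      s (a∉s ∷ _) = (λ ()) , λ a∈s → All.lookup a∉s a∈s refl
Unique-middle (x ∷ p) s (x∉ ∷ u)  with Unique-middle p s u
... | a∉p , a∉s = (λ { (here refl) → All.lookup x∉ (∈-++⁺ʳ p (here refl)) refl ; (there a∈p) → a∉p a∈p }) , a∉s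

descentPosition<n : ∀ {n} p {a b : ℕ} s → IsPerm n (p ++ a ∷ b ∷ s) → suc (length p) < n
descentPosition<n p {a} {b} s w↭ = subst (suc (length p) <_) (IsPerm⇒length w↭) (middle-next<length p a b s)

smallerCount : ℕ → List ℕ → ℕ
smallerCount x l = length (filter (λ y → y <? x) l)

smallerCount-resp-↭ : ∀ x {l l′} → l ↭ l′ → smallerCount x l ≡ smallerCount x l′
smallerCount-resp-↭ x l↭l′ = ↭-length (filter-↭ (λ y → y <? x) l↭l′)

len-addInversion : ∀ p {a b} s → b < a → len (p ++ b ∷ a ∷ s) < len (p ++ a ∷ b ∷ s)
len-addInversion [] {a} {b} s b<a
  rewrite filter-accept (λ y → y <? a) {b} {s} b<a | filter-reject (λ y → y <? b) {a} {s} (<-asym b<a) =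
  s≤s (≤-reflexive (begin
    B + (A + L) ≡⟨ sym (+-assoc B A L) ⟩
    B + A + L   ≡⟨ cong (_+ L) (+-comm B A) ⟩
    A + B + L   ≡⟨ +-assoc A B L ⟩
    A + (B + L) ∎))
  where
  open ≡-Reasoning
  A = smallerCount a s
  B = smallerCount b s
  L = len s
len-addInversion (x ∷ p) {a} {b} s b<a =
  subst (λ c → c + len (p ++ b ∷ a ∷ s) < smallerCount x (p ++ a ∷ b ∷ s) + len (p ++ a ∷ b ∷ s))
    (smallerCount-resp-↭ x (++⁺ˡ p (swap a b ↭-refl)))
    (+-monoʳ-< (smallerCount x (p ++ a ∷ b ∷ s)) (len-addInversion p s b<a))

Appends : ℕ → List ℕ → Set
Appends x r = rowInsert x r ≡ (r ++ x ∷ [] , nothing)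

∈-rowInsert : ∀ x r → x ∈ proj₁ (rowInsert x r)
∈-rowInsert x []       = here refl
∈-rowInsert x (y ∷ ys) with x <ᵇ y
... | true  = here refl
... | false = there (∈-rowInsert x ys)

∈-rowInsert⁻ : ∀ x r {z} → z ∈ proj₁ (rowInsert x r) → z ≡ x ⊎ z ∈ r
∈-rowInsert⁻ x []       (here z≡x) = inj₁ z≡x
∈-rowInsert⁻ x (y ∷ ys) z∈ with x <ᵇ y
∈-rowInsert⁻ x (y ∷ ys) (here z≡x)  | true  = inj₁ z≡x
∈-rowInsert⁻ x (y ∷ ys) (there z∈)  | true  = inj₂ (there z∈)
∈-rowInsert⁻ x (y ∷ ys) (here z≡y)  | false = inj₂ (here z≡y)
∈-rowInsert⁻ x (y ∷ ys) (there z∈)  | false = ⊎-map₂ there (∈-rowInsert⁻ x ys z∈)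

∈-rowInsert-smaller : ∀ x r {z} → z ∈ r → z < x → z ∈ proj₁ (rowInsert x r)
∈-rowInsert-smaller x (y ∷ ys) z∈ z<x with x <ᵇ y | <ᵇ-reflects-< x y
∈-rowInsert-smaller x (y ∷ ys) (here refl) z<x | true  | ofʸ x<y = ⊥-elim (<-asym z<x x<y)
∈-rowInsert-smaller x (y ∷ ys) (there z∈)  z<x | true  | _       = there z∈
∈-rowInsert-smaller x (y ∷ ys) (here z≡y)  z<x | false | _       = here z≡y
∈-rowInsert-smaller x (y ∷ ys) (there z∈)  z<x | false | _       = there (∈-rowInsert-smaller x ys z∈ z<x)

bumped-∈ : ∀ x r {y} → proj₂ (rowInsert x r) ≡ just y → y ∈ r
bumped-∈ x (z ∷ zs) bump with x <ᵇ z
bumped-∈ x (z ∷ zs) refl | true  = here refl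
bumped-∈ x (z ∷ zs) bump | false = there (bumped-∈ x zs bump)

bumped-> : ∀ x r {y} → proj₂ (rowInsert x r) ≡ just y → x < y
bumped-> x (z ∷ zs) bump with x <ᵇ z | <ᵇ-reflects-< x z
bumped-> x (z ∷ zs) refl | true  | ofʸ x<z = x<z
bumped-> x (z ∷ zs) bump | false | _       = bumped-> x zs bump

nothing-bumped⇒Appends : ∀ x r → proj₂ (rowInsert x r) ≡ nothing → Appends x r
nothing-bumped⇒Appends x []       _    = refl
nothing-bumped⇒Appends x (y ∷ ys) bump with x <ᵇ y
nothing-bumped⇒Appends x (y ∷ ys) ()   | true
nothing-bumped⇒Appends x (y ∷ ys) bump | false rewrite nothing-bumped⇒Appends x ys bump = refl

Appends-∷ : ∀ {a} z {zs} → ¬ a < z → Appends a zs → Appends a (z ∷ zs)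
Appends-∷ {a} z a≮z app with a <ᵇ z | <ᵇ-reflects-< a z
... | true  | ofʸ a<z = ⊥-elim (a≮z a<z)
... | false | _       rewrite app = refl

Appends-∷⁻ : ∀ {a} z {zs} → Appends a (z ∷ zs) → ¬ a < z × Appends a zs
Appends-∷⁻ {a} z app with a <ᵇ z | <ᵇ-reflects-< a z
Appends-∷⁻ z ()  | true  | _
Appends-∷⁻ z app | false | ofⁿ a≮z = a≮z , cong (λ (r , m) → (drop 1 r , m)) app

bumped-∈-init : ∀ {x z c y} R → z ∈ R → x < z → proj₂ (rowInsert x (R ++ c ∷ [])) ≡ just y → y ∈ R
bumped-∈-init {x} (u ∷ us) z∈ x<z bump with x <ᵇ u | <ᵇ-reflects-< x u
bumped-∈-init (u ∷ us) z∈          x<z refl | true  | _        = here refl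
bumped-∈-init (u ∷ us) (here refl) x<z bump | false | ofⁿ x≮u = ⊥-elim (x≮u x<z)
bumped-∈-init (u ∷ us) (there z∈)  x<z bump | false | _        = there (bumped-∈-init us z∈ x<z bump)

rowInsert-∷ʳ-larger : ∀ {a b} R → b < a →
  proj₂ (rowInsert b (R ++ a ∷ [])) ≡ just a
  ⊎ ∃[ R′ ] ∃[ y ] (rowInsert b R ≡ (R′ , just y) × rowInsert b (R ++ a ∷ []) ≡ (R′ ++ a ∷ [] , just y))
rowInsert-∷ʳ-larger {a} {b} [] b<a with b <ᵇ a | <ᵇ-reflects-< b a
... | true  | _        = inj₁ refl
... | false | ofⁿ b≮a = ⊥-elim (b≮a b<a)
rowInsert-∷ʳ-larger {a} {b} (z ∷ zs) b<a with b <ᵇ z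
... | true  = inj₂ (b ∷ zs , z , refl , refl)
... | false with rowInsert-∷ʳ-larger zs b<a
...   | inj₁ bumpsA                   = inj₁ bumpsA
...   | inj₂ (R′ , y , bump , bump′) rewrite bump | bump′ = inj₂ (z ∷ R′ , y , refl , refl)

Appends-after-bump : ∀ {a b} R {R′ y} → b < a → Appends a R → rowInsert b R ≡ (R′ , just y) → Appends a R′
Appends-after-bump {a} {b} (z ∷ zs) b<a app bump with b <ᵇ z
Appends-after-bump {a} {b} (z ∷ zs) b<a app refl | true =
  Appends-∷ b (<-asym b<a) (proj₂ (Appends-∷⁻ z app))
Appends-after-bump {a} {b} (z ∷ zs) b<a app bump | false with rowInsert b zs in bumpZs
Appends-after-bump {a} {b} (z ∷ zs) b<a app refl | false | R₀ , just y =
  Appends-∷ z (proj₁ (Appends-∷⁻ z app)) (Appends-after-bump zs b<a (proj₂ (Appends-∷⁻ z app)) bumpZs)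

firstRow : Tableau → List ℕ
firstRow []      = []
firstRow (r ∷ _) = r

lowerRows : Tableau → Tableau
lowerRows []       = []
lowerRows (_ ∷ rs) = rs

insertMaybe : Maybe ℕ → Tableau → Tableau
insertMaybe nothing  T = T
insertMaybe (just y) T = insert T y

insert-row : ∀ T {x r′ m} → rowInsert x (firstRow T) ≡ (r′ , m) → insert T x ≡ r′ ∷ insertMaybe m (lowerRows T)
insert-row []       refl = refl
insert-row (r ∷ rs) {x} bump with rowInsert x r
insert-row (r ∷ rs) refl | r′ , nothing = refl
insert-row (r ∷ rs) refl | r′ , just y  = refl

firstRow-insert : ∀ T x → firstRow (insert T x) ≡ proj₁ (rowInsert x (firstRow T))
firstRow-insert T x = cong firstRow (insert-row T refl)

firstRowBump-unfold : ∀ T x → firstRowBump T x ≡ proj₂ (rowInsert x (firstRow T))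
firstRowBump-unfold []       x = refl
firstRowBump-unfold (r ∷ rs) x with rowInsert x r
... | _ , _ = refl

concat-rows : ∀ T → concat T ≡ firstRow T ++ concat (lowerRows T)
concat-rows []       = refl
concat-rows (r ∷ rs) = refl

firstRow⊆ : ∀ T {z} → z ∈ firstRow T → z ∈ concat T
firstRow⊆ T z∈ = subst (_ ∈_) (sym (concat-rows T)) (∈-++⁺ˡ z∈)

lowerRows⊆ : ∀ T {z} → z ∈ concat (lowerRows T) → z ∈ concat T
lowerRows⊆ T z∈ = subst (_ ∈_) (sym (concat-rows T)) (∈-++⁺ʳ (firstRow T) z∈)

Row₂⊆lowerRows : ∀ T {z} → z ∈ Row₂ T → z ∈ concat (lowerRows T)
Row₂⊆lowerRows (_ ∷ _ ∷ _) z∈ = ∈-++⁺ˡ z∈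

∈-insert⁻ : ∀ T x {z} → z ∈ concat (insert T x) → z ≡ x ⊎ z ∈ concat T
∈-insert⁻ []       x (here z≡x) = inj₁ z≡x
∈-insert⁻ (r ∷ rs) x {z} z∈ with rowInsert x r in bump
... | r′ , nothing with ∈-++⁻ r′ z∈
...   | inj₁ z∈r′ = ⊎-map₂ ∈-++⁺ˡ (∈-rowInsert⁻ x r (subst (λ q → z ∈ proj₁ q) (sym bump) z∈r′))
...   | inj₂ z∈rs = inj₂ (∈-++⁺ʳ r z∈rs)
∈-insert⁻ (r ∷ rs) x {z} z∈ | r′ , just y with ∈-++⁻ r′ z∈
...   | inj₁ z∈r′ = ⊎-map₂ ∈-++⁺ˡ (∈-rowInsert⁻ x r (subst (λ q → z ∈ proj₁ q) (sym bump) z∈r′))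
...   | inj₂ z∈rs′ with ∈-insert⁻ rs y z∈rs′
...     | inj₁ refl = inj₂ (∈-++⁺ˡ (bumped-∈ x r (cong proj₂ bump)))
...     | inj₂ z∈rs = inj₂ (∈-++⁺ʳ r z∈rs)

∈-lowerRows-insert⁻ : ∀ T x {z} → z ∈ concat (lowerRows (insert T x)) →
                      z ∈ concat (lowerRows T) ⊎ proj₂ (rowInsert x (firstRow T)) ≡ just z
∈-lowerRows-insert⁻ (r ∷ rs) x z∈ with rowInsert x r
... | r′ , nothing = inj₁ z∈
... | r′ , just y with ∈-insert⁻ rs y z∈
...   | inj₁ refl = inj₂ refl
...   | inj₂ z∈rs = inj₁ z∈rs

∈-foldl-insert⁻ : ∀ T l {z} → z ∈ concat (foldl insert T l) → z ∈ concat T ⊎ z ∈ l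
∈-foldl-insert⁻ T []      z∈ = inj₁ z∈
∈-foldl-insert⁻ T (x ∷ l) z∈ with ∈-foldl-insert⁻ (insert T x) l z∈
... | inj₂ z∈l = inj₂ (there z∈l)
... | inj₁ z∈T with ∈-insert⁻ T x z∈T
...   | inj₁ z≡x  = inj₂ (here z≡x)
...   | inj₂ z∈T′ = inj₁ z∈T′

∈-P⁻ : ∀ l {z} → z ∈ concat (P l) → z ∈ l
∈-P⁻ l z∈ with ∈-foldl-insert⁻ [] l z∈
... | inj₂ z∈l = z∈l

P-++ : ∀ p q → P (p ++ q) ≡ foldl insert (P p) q
P-++ p q = foldl-++ insert [] p q

insert-knuth : ∀ T {a b R′ y} → Appends a (firstRow T) → rowInsert b (firstRow T) ≡ (R′ , just y) →
               rowInsert b (firstRow T ++ a ∷ []) ≡ (R′ ++ a ∷ [] , just y) → Appends a R′ →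
               insert (insert T a) b ≡ insert (insert T b) a
insert-knuth T {a} {b} {R′} {y} appR bumpR bumpRa appR′ = begin
  insert (insert T a) b                                ≡⟨ cong (λ U → insert U b) (insert-row T appR) ⟩
  insert ((firstRow T ++ a ∷ []) ∷ lowerRows T) b      ≡⟨ insert-row ((firstRow T ++ a ∷ []) ∷ _) bumpRa ⟩
  (R′ ++ a ∷ []) ∷ insert (lowerRows T) y              ≡⟨ insert-row (R′ ∷ _) appR′ ⟨
  insert (R′ ∷ insert (lowerRows T) y) a               ≡⟨ cong (λ U → insert U a) (insert-row T bumpR) ⟨
  insert (insert T b) a                                ∎
  where open ≡-Reasoning

OnlyInFirstRow : ℕ → Tableau → Set
OnlyInFirstRow a T = a ∈ firstRow T × a ∉ concat (lowerRows T)

insert-new-OnlyInFirstRow : ∀ {a} T → a ∉ concat T → OnlyInFirstRow a (insert T a)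
insert-new-OnlyInFirstRow {a} T a∉T =
  subst (a ∈_) (sym (firstRow-insert T a)) (∈-rowInsert a (firstRow T)) ,
  [ a∉T ∘ lowerRows⊆ T , (λ bump → a∉T (firstRow⊆ T (bumped-∈ a (firstRow T) bump))) ]′
    ∘ ∈-lowerRows-insert⁻ T a

insert-larger-OnlyInFirstRow : ∀ {a x} T → a < x → OnlyInFirstRow a T → OnlyInFirstRow a (insert T x)
insert-larger-OnlyInFirstRow {a} {x} T a<x (a∈R , a∉rest) =
  subst (a ∈_) (sym (firstRow-insert T x)) (∈-rowInsert-smaller x (firstRow T) a∈R a<x) ,
  [ a∉rest , (λ bump → <-asym a<x (bumped-> x (firstRow T) bump)) ]′ ∘ ∈-lowerRows-insert⁻ T x

foldl-larger-OnlyInFirstRow : ∀ {a} T l → All (a <_) l → OnlyInFirstRow a T → OnlyInFirstRow a (foldl insert T l)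
foldl-larger-OnlyInFirstRow T []      []           only = only
foldl-larger-OnlyInFirstRow T (x ∷ l) (a<x ∷ a<l) only =
  foldl-larger-OnlyInFirstRow (insert T x) l a<l (insert-larger-OnlyInFirstRow T a<x only)

P-OnlyInFirstRow : ∀ p {a} q → a ∉ p → All (a <_) q → OnlyInFirstRow a (P (p ++ a ∷ q))
P-OnlyInFirstRow p {a} q a∉p a<q = subst (OnlyInFirstRow a) (sym (P-++ p (a ∷ q)))
  (foldl-larger-OnlyInFirstRow (insert (P p) a) q a<q (insert-new-OnlyInFirstRow (P p) (a∉p ∘ ∈-P⁻ p)))

minimal⇒IsPerm : ∀ {n w} → MinimalInC n w → IsPerm n w
minimal⇒IsPerm (((w↭ , _) , _) , _) = w↭

minimal⇒length : ∀ {n w} → MinimalInC n w → length w ≡ n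
minimal⇒length = IsPerm⇒length ∘ minimal⇒IsPerm

minimal-Unique-middle : ∀ {n} p {a} s → MinimalInC n (p ++ a ∷ s) → a ∉ p × a ∉ s
minimal-Unique-middle p s = Unique-middle p s ∘ IsPerm⇒Unique ∘ minimal⇒IsPerm

swap-InC : ∀ {n} p {a b} s → b < a → InC n (p ++ a ∷ b ∷ s) →
           P (p ++ b ∷ a ∷ s) ≡ P (p ++ a ∷ b ∷ s) → InC n (p ++ b ∷ a ∷ s)
swap-InC {n} p {a} {b} s b<a ((w↭ , no321) , crowded) sameP =
  (↭-trans (++⁺ˡ p (swap b a ↭-refl)) w↭ ,
   no321 ∘ Contains321-addInversion n p s b<a (descentPosition<n p s w↭)) ,
  subst (Crowded ∘ Row₂) (sym sameP) crowded

swap-WeakStep : ∀ {n} p {a b} s → b < a → suc (length p) < n → WeakStep n (p ++ b ∷ a ∷ s) (p ++ a ∷ b ∷ s)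
swap-WeakStep p {a} {b} s b<a d<n =
  suc (length p) , s≤s z≤n , d<n , sym (swapAt-middle p a b s) , len-addInversion p s b<a

minimal-descent-Appends : ∀ {n} p {a b} s → MinimalInC n (p ++ a ∷ b ∷ s) → b < a → Appends a (firstRow (P p))
minimal-descent-Appends p {a} s ((((w↭ , no321) , _) , _)) b<a
  with proj₂ (rowInsert a (firstRow (P p))) in bump
... | nothing = nothing-bumped⇒Appends a (firstRow (P p)) bump
... | just y with ∈⇒at (∈-P⁻ p (firstRow⊆ (P p) (bumped-∈ a (firstRow (P p)) bump)))
...   | i , 1≤i , i≤p , pᵢ≡y = ⊥-elim (no321
  (i , suc (length p) , suc (suc (length p)) , 1≤i , s≤s i≤p , n<1+n _ , descentPosition<n p s w↭ ,
   subst₂ _>_ (sym (trans (at-++ˡ p _ i i≤p) pᵢ≡y)) (sym (at-middle p a _)) (bumped-> a (firstRow (P p)) bump) ,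
   subst₂ _>_ (sym (at-middle p a _)) (sym (at-middle-next p a _ s)) b<a))

minimal-descent-bumps : ∀ {n} p {a b} s → MinimalInC n (p ++ a ∷ b ∷ s) → b < a →
                        proj₂ (rowInsert b (firstRow (P p) ++ a ∷ [])) ≡ just a
minimal-descent-bumps p {a} {b} s min@(inC , minimal) b<a with rowInsert-∷ʳ-larger (firstRow (P p)) b<a
... | inj₁ bumpsA = bumpsA
... | inj₂ (R′ , _ , bumpR , bumpRa) = ⊥-elim (<-irrefl b≡a b<a)
  where
  appR = minimal-descent-Appends p s min b<a
  sameP : P (p ++ b ∷ a ∷ s) ≡ P (p ++ a ∷ b ∷ s)
  sameP = begin
    P (p ++ b ∷ a ∷ s)                       ≡⟨ P-++ p _ ⟩
    foldl insert (insert (insert (P p) b) a) s ≡⟨ cong (λ U → foldl insert U s)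
                                                     (insert-knuth (P p) appR bumpR bumpRa
                                                       (Appends-after-bump _ b<a appR bumpR)) ⟨
    foldl insert (insert (insert (P p) a) b) s ≡⟨ P-++ p _ ⟨
    P (p ++ a ∷ b ∷ s)                       ∎
    where open ≡-Reasoning
  b≡a : b ≡ a
  b≡a = ∷-injectiveˡ (++-cancelˡ p _ _ (minimal _ (swap-InC p s b<a inC sameP)
          (swap-WeakStep p s b<a (descentPosition<n p s (minimal⇒IsPerm min)) ◅ ε)))

minimal-descent-BumpedBy : ∀ {n} p {a b} s → MinimalInC n (p ++ a ∷ b ∷ s) → b < a →
                           BumpedBy (p ++ a ∷ b ∷ s) (suc (length p))
minimal-descent-BumpedBy p {a} {b} s min b<a
  rewrite take-middle p a (b ∷ s) | at-middle-next p a b s | at-middle p a (b ∷ s) | P-++ p (a ∷ []) = begin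
    firstRowBump (insert (P p) a) b                 ≡⟨ firstRowBump-unfold (insert (P p) a) b ⟩
    proj₂ (rowInsert b (firstRow (insert (P p) a))) ≡⟨ cong (λ r → proj₂ (rowInsert b (firstRow r)))
                                                        (insert-row (P p) (minimal-descent-Appends p s min b<a)) ⟩
    proj₂ (rowInsert b (firstRow (P p) ++ a ∷ []))  ≡⟨ minimal-descent-bumps p s min b<a ⟩
    just a                                          ∎
  where open ≡-Reasoning

minimal-descent⇒BumpedBy : ∀ {n w d} → MinimalInC n w → Descent n w d → BumpedBy w d
minimal-descent⇒BumpedBy {w = w} {suc k} min (_ , d<n , wd>wd+1)
  with split-at₂ w k (subst (suc k <_) (sym (minimal⇒length min)) d<n)
... | p , a , b , s , refl , refl =
  minimal-descent-BumpedBy p s min (subst₂ _>_ (at-middle p a (b ∷ s)) (at-middle-next p a b s) wd>wd+1)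

BumpedBy⇒< : ∀ w d → BumpedBy w d → at w d > at w (suc d)
BumpedBy⇒< w d bb = bumped-> _ (firstRow (P (take d w))) (trans (sym (firstRowBump-unfold (P (take d w)) _)) bb)

minimal-descent-firstRow≤ : ∀ {n} p {c e} s → MinimalInC n (p ++ c ∷ e ∷ s) → e < c →
                            ∀ {z} → z ∈ firstRow (P p) → z ≤ e
minimal-descent-firstRow≤ p s min e<c z∈R = ≮⇒≥ λ e<z →
  proj₁ (minimal-Unique-middle p _ min)
    (∈-P⁻ p (firstRow⊆ (P p) (bumped-∈-init (firstRow (P p)) z∈R e<z (minimal-descent-bumps p s min e<c))))

minimal-noLargerRun : ∀ {n} p {a} q {c e} s → MinimalInC n (p ++ a ∷ (q ∷ʳ c) ++ e ∷ s) →
                      All (a <_) (q ∷ʳ c) → ¬ e < a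
minimal-noLargerRun p {a} q {c} {e} s min a<qc e<a = <⇒≱ e<a (minimal-descent-firstRow≤ (p ++ a ∷ q) s min′ e<c a∈R)
  where
  reassoc : p ++ a ∷ (q ∷ʳ c) ++ e ∷ s ≡ (p ++ a ∷ q) ++ c ∷ e ∷ s
  reassoc = trans (cong (λ t → p ++ a ∷ t) (++-assoc q (c ∷ []) (e ∷ s))) (sym (++-assoc p (a ∷ q) (c ∷ e ∷ s)))
  min′ = subst (MinimalInC _) reassoc min
  e<c = <-trans e<a (All.lookup a<qc (∈-++⁺ʳ q (here refl)))
  a∉p = proj₁ (minimal-Unique-middle p _ min)
  a∈R = proj₁ (P-OnlyInFirstRow p q a∉p (++⁻ˡ q a<qc))

minimal-Row₂⇒nextSmaller : ∀ {n} p {a} s → MinimalInC n (p ++ a ∷ s) → a ∈ Row₂ (P (p ++ a ∷ s)) →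
                           ∃[ b ] ∃[ s′ ] (s ≡ b ∷ s′ × b < a)
minimal-Row₂⇒nextSmaller p {a} s min a∈Row₂ with minimal-Unique-middle p s min
... | a∉p , a∉s with First.first (λ x → ⊎-swap (≤-<-connex x a)) s
...   | inj₂ a<s = ⊥-elim (proj₂ (P-OnlyInFirstRow p s a∉p a<s) (Row₂⊆lowerRows (P (p ++ a ∷ s)) a∈Row₂))
...   | inj₁ firstSmaller with toView firstSmaller
...     | First._++_∷_ {q} {e} a<q e≤a s′ with ≤∧≢⇒< e≤a (λ e≡a → a∉s (∈-++⁺ʳ q (here (sym e≡a))))
...       | e<a with initLast q
...         | []       = e , s′ , refl , e<a
...         | q′ ∷ʳ′ c = ⊥-elim (minimal-noLargerRun p q′ s′ min a<q e<a)

minimal-Row₂⇒Descent : ∀ {n w d} → MinimalInC n w → 1 ≤ d → d ≤ n → at w d ∈ Row₂ (P w) → Descent n w d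
minimal-Row₂⇒Descent {w = w} {suc k} min _ d≤n wd∈Row₂
  with split-at w k (subst (k <_) (sym (minimal⇒length min)) d≤n)
... | p , a , s , refl , refl
  with minimal-Row₂⇒nextSmaller p s min (subst (_∈ Row₂ (P (p ++ a ∷ s))) (at-middle p a s) wd∈Row₂)
...   | b , s′ , refl , b<a =
  s≤s z≤n , descentPosition<n p s′ (minimal⇒IsPerm min) ,
  subst₂ _>_ (sym (at-middle p a (b ∷ s′))) (sym (at-middle-next p a b s′)) b<a

corollary5p5 : (n : ℕ) (w : List ℕ) → MinimalInC n w →
    ((d : ℕ) → 1 ≤ d → d < n → (Descent n w d ⇔ BumpedBy w d))
    × ((d : ℕ) → 1 ≤ d → d ≤ n → at w d ∈ Row₂ (P w) → d < n × BumpedBy w d)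
corollary5p5 n w min = descent⇔bumped , row₂⇒bumped
  where
  descent⇔bumped : (d : ℕ) → 1 ≤ d → d < n → (Descent n w d ⇔ BumpedBy w d)
  descent⇔bumped d 1≤d d<n =
    mk⇔ (minimal-descent⇒BumpedBy min) (λ bumped → 1≤d , d<n , BumpedBy⇒< w d bumped)
  row₂⇒bumped : (d : ℕ) → 1 ≤ d → d ≤ n → at w d ∈ Row₂ (P w) → d < n × BumpedBy w d
  row₂⇒bumped d 1≤d d≤n wd∈Row₂ = proj₁ (proj₂ descent) , minimal-descent⇒BumpedBy min descent
    where descent = minimal-Row₂⇒Descent min 1≤d d≤n wd∈Row₂
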